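{- Let $L$ be a set of formulas that contains all theorems of monotone modal logic $\mathsf{M}$ and is closed under modus ponens and the congruence rule (from $A\to B$ and $B\to A$ infer $\Box A\to\Box B$). If $L$ contains a formula of the form $\Box A_1\lor\dots\lor\Box A_n$ (with $n\geq1$), then $\Box\top\in L$. In particular, $\Box\top$ is a theorem of $\mathsf{M5}$.
   Context: Formulas: propositional variables, $\bot,\top,\neg,\land,\lor,\to,\Box$. Monotone modal logic $\mathsf{M}$ is the smallest set of formulas containing the propositional tautologies and all instances of $\Box(A\land B)\to(\Box A\land\Box B)$, closed under modus ponens and the congruence rule. $\mathsf{M5}$ is defined in the same way but additionally containing all instances of the axiom $\mathsf{5}: \Box A\lor\Box\neg\Box A$. -}

module Defs where

open import Data.Nat using (ℕ)
open import Data.Bool using (Bool; true; false; _∧_; _∨_; not)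
open import Data.List.NonEmpty using (List⁺; _∷_)
open import Data.List using (List; []; _∷_)
open import Relation.Binary.PropositionalEquality using (_≡_)
open import Level using (Level; suc)

data Formula : Set where
  var  : ℕ → Formula
  ⊥'   : Formula
  ⊤'   : Formula
  ¬'_  : Formula → Formula
  _∧'_ : Formula → Formula → Formula
  _∨'_ : Formula → Formula → Formula
  _⇒_  : Formula → Formula → Formula
  □_   : Formula → Formula

infixr 20 ¬'_ □_
infixr 15 _∧'_
infixr 14 _∨'_
infixr 13 _⇒_

eval : (ℕ → Bool) → (Formula → Bool) → Formula → Bool
eval v w (var n)   = v n
eval v w ⊥'        = false
eval v w ⊤'        = true
eval v w (¬' A)    = not (eval v w A)
eval v w (A ∧' B)  = eval v w A ∧ eval v w B
eval v w (A ∨' B)  = eval v w A ∨ eval v w B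
eval v w (A ⇒ B)   = not (eval v w A) ∨ eval v w B
eval v w (□ A)     = w A

-- Propositional tautologies (instances of tautologies in the modal language).
Tautology : Formula → Set
Tautology A = ∀ (v : ℕ → Bool) (w : Formula → Bool) → eval v w A ≡ true

data M : Formula → Set where
  taut : ∀ {A} → Tautology A → M A
  mono : ∀ A B → M (□ (A ∧' B) ⇒ (□ A ∧' □ B))
  mp   : ∀ {A B} → M A → M (A ⇒ B) → M B
  cong : ∀ {A B} → M (A ⇒ B) → M (B ⇒ A) → M (□ A ⇒ □ B)

data M5 : Formula → Set where
  taut : ∀ {A} → Tautology A → M5 A
  mono : ∀ A B → M5 (□ (A ∧' B) ⇒ (□ A ∧' □ B))
  ax5  : ∀ A → M5 (□ A ∨' □ ¬' □ A)
  mp   : ∀ {A B} → M5 A → M5 (A ⇒ B) → M5 B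
  cong : ∀ {A B} → M5 (A ⇒ B) → M5 (B ⇒ A) → M5 (□ A ⇒ □ B)

boxDisj' : Formula → List Formula → Formula
boxDisj' A [] = □ A
boxDisj' A (B ∷ Bs) = □ A ∨' boxDisj' B Bs

boxDisj : List⁺ Formula → Formula
boxDisj (A ∷ As) = boxDisj' A As

ContainsM : ∀ {ℓ} → (Formula → Set ℓ) → Set ℓ
ContainsM L = ∀ {A} → M A → L A

ClosedMP : ∀ {ℓ} → (Formula → Set ℓ) → Set ℓ
ClosedMP L = ∀ {A B} → L A → L (A ⇒ B) → L B

ClosedCong : ∀ {ℓ} → (Formula → Set ℓ) → Set ℓ
ClosedCong L = ∀ {A B} → L (A ⇒ B) → L (B ⇒ A) → L (□ A ⇒ □ B)

-- M proves □ A ⇒ □ ⊤ for every A: congruence turns the tautological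
-- equivalence A ⇔ A ∧ ⊤ into □ A ⇒ □ (A ∧ ⊤), and monotonicity weakens this
-- to □ ⊤. Hence M proves □ A₁ ∨ … ∨ □ Aₙ ⇒ □ ⊤ by disjunction elimination,
-- and any L containing M and closed under modus ponens inherits □ ⊤ from a
-- boxed disjunction. For M5, axiom 5 at ⊤ is the boxed disjunction
-- □ ⊤ ∨ □ ¬ □ ⊤.
module Submission where

open import Defs
open import Data.Product using (_×_; _,_)
open import Data.List.NonEmpty using (List⁺; _∷_)
open import Data.List using ([]; _∷_)
open import Data.Bool using (true; false)
open import Relation.Binary.PropositionalEquality using (refl)

⇒-∧⊤-taut : ∀ A → Tautology (A ⇒ A ∧' ⊤')
⇒-∧⊤-taut A v w with eval v w A
... | true  = refl
... | false = refl

∧⊤-⇒-taut : ∀ A → Tautology (A ∧' ⊤' ⇒ A)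
∧⊤-⇒-taut A v w with eval v w A
... | true  = refl
... | false = refl

∧-proj₂-taut : ∀ A B → Tautology (A ∧' B ⇒ B)
∧-proj₂-taut A B v w with eval v w A | eval v w B
... | true  | true  = refl
... | true  | false = refl
... | false | true  = refl
... | false | false = refl

⇒-trans-taut : ∀ A B C → Tautology ((A ⇒ B) ⇒ (B ⇒ C) ⇒ A ⇒ C)
⇒-trans-taut A B C v w with eval v w A | eval v w B | eval v w C
... | true  | true  | true  = refl
... | true  | true  | false = refl
... | true  | false | true  = refl
... | true  | false | false = refl
... | false | true  | true  = refl
... | false | true  | false = refl
... | false | false | true  = refl
... | false | false | false = refl

∨-elim-taut : ∀ A B C → Tautology ((A ⇒ C) ⇒ (B ⇒ C) ⇒ A ∨' B ⇒ C)
∨-elim-taut A B C v w with eval v w A | eval v w B | eval v w C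
... | true  | true  | true  = refl
... | true  | true  | false = refl
... | true  | false | true  = refl
... | true  | false | false = refl
... | false | true  | true  = refl
... | false | true  | false = refl
... | false | false | true  = refl
... | false | false | false = refl

M-⇒-trans : ∀ {A B C} → M (A ⇒ B) → M (B ⇒ C) → M (A ⇒ C)
M-⇒-trans {A} {B} {C} A⇒B B⇒C = mp B⇒C (mp A⇒B (taut (⇒-trans-taut A B C)))

M-∨-elim : ∀ {A B C} → M (A ⇒ C) → M (B ⇒ C) → M (A ∨' B ⇒ C)
M-∨-elim {A} {B} {C} A⇒C B⇒C = mp B⇒C (mp A⇒C (taut (∨-elim-taut A B C)))

□⇒□⊤ : ∀ A → M (□ A ⇒ □ ⊤')
□⇒□⊤ A =
  M-⇒-trans (cong (taut (⇒-∧⊤-taut A)) (taut (∧⊤-⇒-taut A)))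
    (M-⇒-trans (mono A ⊤') (taut (∧-proj₂-taut (□ A) (□ ⊤'))))

boxDisj'⇒□⊤ : ∀ A As → M (boxDisj' A As ⇒ □ ⊤')
boxDisj'⇒□⊤ A []       = □⇒□⊤ A
boxDisj'⇒□⊤ A (B ∷ Bs) = M-∨-elim (□⇒□⊤ A) (boxDisj'⇒□⊤ B Bs)

□⊤-from-boxDisj : (L : Formula → Set) → ContainsM L → ClosedMP L →
                  (As : List⁺ Formula) → L (boxDisj As) → L (□ ⊤')
□⊤-from-boxDisj L containsM closedMP (A ∷ As) ⊢disj =
  closedMP ⊢disj (containsM (boxDisj'⇒□⊤ A As))

M⊆M5 : ContainsM M5
M⊆M5 (taut t)   = taut t
M⊆M5 (mono A B) = mono A B
M⊆M5 (mp p q)   = mp (M⊆M5 p) (M⊆M5 q)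
M⊆M5 (cong p q) = cong (M⊆M5 p) (M⊆M5 q)

mainTheorem13 : (∀ (L : Formula → Set) → ContainsM L → ClosedMP L → ClosedCong L → (As : List⁺ Formula) → L (boxDisj As) → L (□ ⊤')) × M5 (□ ⊤')
mainTheorem13 =
    (λ L containsM closedMP _ → □⊤-from-boxDisj L containsM closedMP)
  , □⊤-from-boxDisj M5 M⊆M5 mp (⊤' ∷ ¬' □ ⊤' ∷ []) (ax5 ⊤')
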